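{- Let $G$ be a bipartite graph. Then the following are equivalent: (i) $G$ has a unique perfect matching; (ii) the $\alpha$-critical edges of $G$ form a maximal matching; (iii) $\eta(G)=\alpha(G)$; (iv) $\eta(G)=\mu(G)$; (v) $2\eta(G)=n(G)$.
   Context: All graphs are finite and simple; "graph" means a connected graph with at least one edge. $\alpha(G)$ is the stability number, $\mu(G)$ the maximum matching size, $n(G)=|V(G)|$. An edge $e$ is $\alpha$-critical if $\alpha(G-e)>\alpha(G)$ ($G-e$ being $G$ with $e$ deleted); $\eta(G)$ is the number of $\alpha$-critical edges of $G$. A maximal matching is one not properly contained in another matching. -}

module Defs where

open import Data.Bool using (Bool; true; false; _∧_; _∨_; not; T; if_then_else_)
open import Data.Nat using (ℕ; zero; suc; _⊔_; _<ᵇ_; _≡ᵇ_)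
open import Data.Fin using (Fin; toℕ)
open import Data.List using (List; []; _∷_; [_]; map; _++_; foldr; filterᵇ; cartesianProduct; length; lookup; allFin)
open import Data.Vec using (Vec; []; _∷_; tabulate) renaming (lookup to vlookup)
open import Data.Product using (Σ; _×_; _,_; ∃; ∃-syntax; proj₁; proj₂)
open import Relation.Binary.PropositionalEquality using (_≡_; _≢_)
open import Relation.Nullary using (¬_)

record Graph : Set where
  field
    n      : ℕ
    adj    : Fin n → Fin n → Bool
    adjSym : ∀ i j → adj i j ≡ adj j i
    adjIrr : ∀ i → adj i i ≡ false
open Graph public

allᵇ : ∀ {A : Set} → (A → Bool) → List A → Bool
allᵇ p = foldr (λ x b → p x ∧ b) true

_=ᵛ_ : ∀ {n} → Fin n → Fin n → Bool
i =ᵛ j = toℕ i ≡ᵇ toℕ j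

data Reach (G : Graph) : Fin (n G) → Fin (n G) → Set where
  here : ∀ {u} → Reach G u u
  step : ∀ {u w v} → adj G u w ≡ true → Reach G w v → Reach G u v

Connected : Graph → Set
Connected G = ∀ u v → Reach G u v

HasEdge : Graph → Set
HasEdge G = Σ (Fin (n G)) λ u → Σ (Fin (n G)) λ v → adj G u v ≡ true

Bipartite : Graph → Set
Bipartite G = Σ (Fin (n G) → Bool) λ c → ∀ u v → adj G u v ≡ true → c u ≢ c v

subsets : (m : ℕ) → List (Vec Bool m)
subsets zero    = [ [] ]
subsets (suc m) = map (true ∷_) (subsets m) ++ map (false ∷_) (subsets m)

size : ∀ {m} → Vec Bool m → ℕ
size []           = 0
size (true ∷ xs)  = suc (size xs)
size (false ∷ xs) = size xs

maxList : List ℕ → ℕ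
maxList = foldr _⊔_ 0

isStableᵇ : ∀ {m} → (Fin m → Fin m → Bool) → Vec Bool m → Bool
isStableᵇ {m} a S =
  allᵇ (λ i → allᵇ (λ j → not (vlookup S i ∧ vlookup S j ∧ a i j)) (allFin m)) (allFin m)

αAdj : ∀ {m} → (Fin m → Fin m → Bool) → ℕ
αAdj {m} a = maxList (map size (filterᵇ (isStableᵇ a) (subsets m)))

α : Graph → ℕ
α G = αAdj (adj G)

edges : (G : Graph) → List (Fin (n G) × Fin (n G))
edges G = filterᵇ (λ { (u , v) → (toℕ u <ᵇ toℕ v) ∧ adj G u v })
                  (cartesianProduct (allFin (n G)) (allFin (n G)))

m : Graph → ℕ
m G = length (edges G)

edge : (G : Graph) → Fin (m G) → Fin (n G) × Fin (n G)
edge G k = lookup (edges G) k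

delEdge : (G : Graph) → Fin (n G) × Fin (n G) → Fin (n G) → Fin (n G) → Bool
delEdge G (u , v) i j = adj G i j ∧ not ((i =ᵛ u ∧ j =ᵛ v) ∨ (i =ᵛ v ∧ j =ᵛ u))

isCriticalᵇ : (G : Graph) → Fin (m G) → Bool
isCriticalᵇ G k = α G <ᵇ αAdj (delEdge G (edge G k))

criticalSet : (G : Graph) → Vec Bool (m G)
criticalSet G = tabulate (isCriticalᵇ G)

η : Graph → ℕ
η G = size (criticalSet G)

-- sets of edges are characteristic vectors over the edge list
EdgeSet : Graph → Set
EdgeSet G = Vec Bool (m G)

disjointᵇ : ∀ {n} → Fin n × Fin n → Fin n × Fin n → Bool
disjointᵇ (a , b) (c , d) = not ((a =ᵛ c) ∨ (a =ᵛ d) ∨ (b =ᵛ c) ∨ (b =ᵛ d))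

isMatchingᵇ : (G : Graph) → EdgeSet G → Bool
isMatchingᵇ G M =
  allᵇ (λ k → allᵇ (λ l → not (vlookup M k ∧ vlookup M l ∧ not (toℕ k ≡ᵇ toℕ l))
                        ∨ disjointᵇ (edge G k) (edge G l))
                 (allFin (m G)))
      (allFin (m G))

IsMatching : (G : Graph) → EdgeSet G → Set
IsMatching G M = T (isMatchingᵇ G M)

μ : Graph → ℕ
μ G = maxList (map size (filterᵇ (isMatchingᵇ G) (subsets (m G))))

covers : (G : Graph) → EdgeSet G → Fin (n G) → Set
covers G M v = Σ (Fin (m G)) λ k → (vlookup M k ≡ true) ×
                 T ((v =ᵛ proj₁ (edge G k)) ∨ (v =ᵛ proj₂ (edge G k)))

IsPerfectMatching : (G : Graph) → EdgeSet G → Set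
IsPerfectMatching G M = IsMatching G M × (∀ v → covers G M v)

HasUniquePerfectMatching : Graph → Set
HasUniquePerfectMatching G =
  Σ (EdgeSet G) λ M → IsPerfectMatching G M × (∀ M′ → IsPerfectMatching G M′ → M′ ≡ M)

_⊆ₑ_ : ∀ {k} → Vec Bool k → Vec Bool k → Set
_⊆ₑ_ {k} M M′ = ∀ (i : Fin k) → vlookup M i ≡ true → vlookup M′ i ≡ true

IsMaximalMatching : (G : Graph) → EdgeSet G → Set
IsMaximalMatching G M = IsMatching G M × (∀ M′ → IsMatching G M′ → M ⊆ₑ M′ → M′ ≡ M)

{-# OPTIONS --safe #-}
-- For bipartite graphs König's theorem gives α + μ = n, both for G and for every G − e.
-- Hence e is α-critical iff μ(G − e) < μ(G), i.e. iff e lies in every maximum matching.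
-- So the critical edges form a matching C contained in every maximum matching, and
-- η ≤ μ ≤ α and 2μ ≤ n. If η = μ, then C is the only maximum matching, and it covers
-- every vertex v: otherwise an edge vu could be added to C, or exchanged for the edge of C
-- at u, giving a maximum matching that misses an edge of C. So C is the unique perfect
-- matching. Conversely, if M is the unique perfect matching, every maximum matching is
-- perfect, hence equal to M, so C = M; this gives (ii)–(v), and each of (ii), (iii), (v)
-- forces η = μ through the inequalities above.
-- König's theorem is proved by augmentation: for a matching M, the set R of vertices of
-- one side A reachable from M-free vertices of A by M-alternating paths either has an
-- M-free neighbour b on the other side B, and M can be augmented along a path to b, or
-- R ∪ (B ∖ N(R)) is a stable set of size n − |M|.

module Submission where

open import Defs
open import Data.Nat using (_*_)
open import Data.Product using (_×_)
open import Function.Bundles using (_⇔_)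
open import Relation.Binary.PropositionalEquality using (_≡_)

open import Data.Bool using (Bool; true; false; not; _∧_; _∨_; T; if_then_else_)
import Data.Bool.Properties as Bool
open import Data.Nat hiding (_≟_)
open import Data.Nat.Properties
open import Data.Nat.Tactic.RingSolver using (solve-∀)
open import Data.Fin using (Fin; zero; suc; toℕ)
import Data.Fin.Properties as Fin
open import Data.List using (List; []; _∷_; map; filterᵇ; lookup; allFin; cartesianProduct)
open import Data.List.Membership.Propositional using (_∈_)
open import Data.List.Membership.Propositional.Properties
import Data.List.Relation.Unary.Any as Any
open Any using (here; there)
open import Data.List.Relation.Unary.Any.Properties using (lookup-index)
import Data.List.Relation.Unary.All as All
open import Data.List.Relation.Unary.AllPairs using (AllPairs; _∷_)
import Data.List.Relation.Unary.Unique.Propositional.Properties as Unique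
open import Data.Vec using (Vec; []; _∷_; tabulate) renaming (lookup to vlookup)
import Data.Vec.Properties as Vec
open import Data.Product using (_,_; ∃-syntax; proj₁; proj₂)
open import Data.Sum using (_⊎_; inj₁; inj₂)
open import Data.Empty using (⊥; ⊥-elim)
open import Data.Unit using (tt)
open import Function using (_∘_; Equivalence; mk⇔)
open import Relation.Binary using (tri<; tri≈; tri>)
open import Relation.Binary.PropositionalEquality
open import Relation.Nullary using (¬_; Dec; yes; no; does)
open import Relation.Nullary.Decidable using (_×-dec_; _⊎-dec_; ¬?; dec-false)
open import Algebra.Properties.Semiring.Sum +-*-semiring
  using (sum; sum-syntax; sum-cong-≗; sum-replicate-zero; ∑-distrib-+; ∑-comm; *-distribˡ-sum)

-- Finite sums and subsets of Fin k

𝟙 : Bool → ℕ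
𝟙 true  = 1
𝟙 false = 0

𝟙≤1 : ∀ b → 𝟙 b ≤ 1
𝟙≤1 true  = ≤-refl
𝟙≤1 false = z≤n

true≢false : true ≢ false
true≢false ()

∧-true : ∀ {x y} → x ∧ y ≡ true → x ≡ true × y ≡ true
∧-true {x} {y} p = Bool.∧-conicalˡ x y p , Bool.∧-conicalʳ x y p

=ᵛ-refl : ∀ {k} (i : Fin k) → (i =ᵛ i) ≡ true
=ᵛ-refl zero    = refl
=ᵛ-refl (suc i) = =ᵛ-refl i

=ᵛ⇒≡ : ∀ {k} {i j : Fin k} → (i =ᵛ j) ≡ true → i ≡ j
=ᵛ⇒≡ {i = zero}  {zero}  _ = refl
=ᵛ⇒≡ {i = suc i} {suc j} p = cong suc (=ᵛ⇒≡ p)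

≢⇒=ᵛ≡false : ∀ {k} {i j : Fin k} → i ≢ j → (i =ᵛ j) ≡ false
≢⇒=ᵛ≡false {i = zero}  {zero}  i≢j = ⊥-elim (i≢j refl)
≢⇒=ᵛ≡false {i = zero}  {suc j} _   = refl
≢⇒=ᵛ≡false {i = suc i} {zero}  _   = refl
≢⇒=ᵛ≡false {i = suc i} {suc j} i≢j = ≢⇒=ᵛ≡false (i≢j ∘ cong suc)

sum-mono-≤ : ∀ {n} {f g : Fin n → ℕ} → (∀ i → f i ≤ g i) → sum f ≤ sum g
sum-mono-≤ {zero}  f≤g = z≤n
sum-mono-≤ {suc n} f≤g = +-mono-≤ (f≤g zero) (sum-mono-≤ (f≤g ∘ suc))

sum-mono-< : ∀ {n} {f g : Fin n → ℕ} → (∀ i → f i ≤ g i) → ∀ k → f k < g k → sum f < sum g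
sum-mono-< f≤g zero    fk<gk = +-mono-<-≤ fk<gk (sum-mono-≤ (f≤g ∘ suc))
sum-mono-< f≤g (suc k) fk<gk = +-mono-≤-< (f≤g zero) (sum-mono-< (f≤g ∘ suc) k fk<gk)

sum-ones : ∀ n → ∑[ i < n ] 1 ≡ n
sum-ones zero    = refl
sum-ones (suc n) = cong suc (sum-ones n)

sum-zeros : ∀ {n} {f : Fin n → ℕ} → (∀ i → f i ≡ 0) → sum f ≡ 0
sum-zeros {n} f≡0 = trans (sum-cong-≗ f≡0) (sum-replicate-zero n)

term≤sum : ∀ {n} (f : Fin n → ℕ) k → f k ≤ sum f
term≤sum f zero    = m≤m+n _ _
term≤sum f (suc k) = ≤-trans (term≤sum (f ∘ suc) k) (m≤n+m _ _)

sum-single : ∀ {n} (f : Fin n → ℕ) k → (∀ i → i ≢ k → f i ≡ 0) → sum f ≡ f k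
sum-single f zero    others = trans (cong (f zero +_) (sum-zeros (λ i → others (suc i) λ ()))) (+-identityʳ _)
sum-single f (suc k) others = trans (cong (_+ sum (f ∘ suc)) (others zero λ ()))
  (sum-single (f ∘ suc) k (λ i i≢k → others (suc i) (i≢k ∘ Fin.suc-injective)))

sum-point : ∀ {n} (x : Fin n) (w : Fin n → ℕ) → ∑[ i < n ] (𝟙 (i =ᵛ x) * w i) ≡ w x
sum-point x w = begin
  ∑[ i < _ ] (𝟙 (i =ᵛ x) * w i)
    ≡⟨ sum-single _ x (λ i i≢x → cong (λ b → 𝟙 b * w i) (≢⇒=ᵛ≡false i≢x)) ⟩
  𝟙 (x =ᵛ x) * w x
    ≡⟨ cong (λ b → 𝟙 b * w x) (=ᵛ-refl x) ⟩
  w x + 0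
    ≡⟨ +-identityʳ (w x) ⟩
  w x ∎
  where open ≡-Reasoning

card : ∀ {k} → (Fin k → Bool) → ℕ
card {k} X = ∑[ i < k ] 𝟙 (X i)

infix 4 _⊆_
_⊆_ : ∀ {k} → (Fin k → Bool) → (Fin k → Bool) → Set
X ⊆ Y = ∀ i → X i ≡ true → Y i ≡ true

⊆-trans : ∀ {k} {X Y Z : Fin k → Bool} → X ⊆ Y → Y ⊆ Z → X ⊆ Z
⊆-trans X⊆Y Y⊆Z i = Y⊆Z i ∘ X⊆Y i

⊆-antisym : ∀ {k} {X Y : Fin k → Bool} → X ⊆ Y → Y ⊆ X → ∀ i → X i ≡ Y i
⊆-antisym {X = X} {Y} X⊆Y Y⊆X i with X i in Xi | Y i in Yi
... | true  | true  = refl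
... | false | false = refl
... | true  | false = trans (sym (X⊆Y i Xi)) Yi
... | false | true  = trans (sym Xi) (Y⊆X i Yi)

module _ {k : ℕ} where

  card≤ : (X : Fin k → Bool) → card X ≤ k
  card≤ X = subst (card X ≤_) (sum-ones k) (sum-mono-≤ (𝟙≤1 ∘ X))

  card-complement : (X : Fin k → Bool) → card X + card (not ∘ X) ≡ k
  card-complement X = trans (sym (∑-distrib-+ (𝟙 ∘ X) (𝟙 ∘ not ∘ X)))
                            (trans (sum-cong-≗ (𝟙-split ∘ X)) (sum-ones k))
    where
    𝟙-split : ∀ b → 𝟙 b + 𝟙 (not b) ≡ 1
    𝟙-split true  = refl
    𝟙-split false = refl

  𝟙-mono : ∀ {X Y : Fin k → Bool} → X ⊆ Y → ∀ i → 𝟙 (X i) ≤ 𝟙 (Y i)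
  𝟙-mono {X} X⊆Y i with X i in Xi
  ... | false = z≤n
  ... | true  rewrite X⊆Y i Xi = ≤-refl

  card-mono-< : ∀ {X Y : Fin k → Bool} → X ⊆ Y → ∀ i → X i ≡ false → Y i ≡ true → card X < card Y
  card-mono-< X⊆Y i Xi Yi = sum-mono-< (𝟙-mono X⊆Y) i (subst₂ (λ a b → 𝟙 a < 𝟙 b) (sym Xi) (sym Yi) ≤-refl)

  ⊆-false : ∀ {X Y : Fin k → Bool} → X ⊆ Y → ∀ {i} → Y i ≡ false → X i ≡ false
  ⊆-false {X} X⊆Y {i} Yi with X i in Xi
  ... | false = refl
  ... | true  = trans (sym (X⊆Y i Xi)) Yi

  ⊆∧card≡⇒⊇ : ∀ {X Y : Fin k → Bool} → X ⊆ Y → card X ≡ card Y → Y ⊆ X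
  ⊆∧card≡⇒⊇ {X} X⊆Y card≡ i Yi with X i in Xi
  ... | true  = refl
  ... | false = ⊥-elim (<-irrefl card≡ (card-mono-< X⊆Y i Xi Yi))

  insert remove : Fin k → (Fin k → Bool) → Fin k → Bool
  insert x X i = (i =ᵛ x) ∨ X i
  remove x X i = not (i =ᵛ x) ∧ X i

  insert-∈ : ∀ x X → insert x X x ≡ true
  insert-∈ x X rewrite =ᵛ-refl x = refl

  ⊆-insert : ∀ x X → X ⊆ insert x X
  ⊆-insert x X i Xi rewrite Xi = Bool.∨-zeroʳ (i =ᵛ x)

  insert⁻ : ∀ x X {i} → insert x X i ≡ true → i ≡ x ⊎ X i ≡ true
  insert⁻ x X {i} p with i =ᵛ x in i=x
  ... | true  = inj₁ (=ᵛ⇒≡ i=x)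
  ... | false = inj₂ p

  insert-⊆ : ∀ {x X Y} → Y x ≡ true → X ⊆ Y → insert x X ⊆ Y
  insert-⊆ {x} {X} Yx X⊆Y i i∈ with insert⁻ x X {i} i∈
  ... | inj₁ refl = Yx
  ... | inj₂ Xi   = X⊆Y i Xi

  remove-∉ : ∀ x X → remove x X x ≡ false
  remove-∉ x X rewrite =ᵛ-refl x = refl

  remove⊆ : ∀ x X → remove x X ⊆ X
  remove⊆ x X i p with i =ᵛ x
  ... | false = p

  remove⁺ : ∀ {x X i} → i ≢ x → X i ≡ true → remove x X i ≡ true
  remove⁺ i≢x Xi rewrite ≢⇒=ᵛ≡false i≢x = Xi

  card-insert : ∀ {x X} → X x ≡ false → card (insert x X) ≡ suc (card X)
  card-insert {x} {X} Xx = begin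
    ∑[ i < k ] 𝟙 (insert x X i)          ≡⟨ sum-cong-≗ 𝟙-insert ⟩
    ∑[ i < k ] (𝟙 (i =ᵛ x) + 𝟙 (X i))   ≡⟨ ∑-distrib-+ (λ i → 𝟙 (i =ᵛ x)) (𝟙 ∘ X) ⟩
    ∑[ i < k ] 𝟙 (i =ᵛ x) + card X      ≡⟨ cong (_+ card X) (card-singleton x) ⟩
    suc (card X)                        ∎
    where
    open ≡-Reasoning
    𝟙-insert : ∀ i → 𝟙 (insert x X i) ≡ 𝟙 (i =ᵛ x) + 𝟙 (X i)
    𝟙-insert i with i Fin.≟ x
    ... | yes refl rewrite =ᵛ-refl i | Xx = refl
    ... | no i≢x   rewrite ≢⇒=ᵛ≡false i≢x = refl
    card-singleton : ∀ x → ∑[ i < k ] 𝟙 (i =ᵛ x) ≡ 1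
    card-singleton x = trans (sum-cong-≗ {k} (λ i → sym (*-identityʳ _))) (sum-point x (λ _ → 1))

  card-remove : ∀ {x X} → X x ≡ true → suc (card (remove x X)) ≡ card X
  card-remove {x} {X} Xx = begin
    suc (card (remove x X))       ≡⟨ sym (card-insert (remove-∉ x X)) ⟩
    card (insert x (remove x X))  ≡⟨ sum-cong-≗ (cong 𝟙 ∘ insert-remove) ⟩
    card X                        ∎
    where
    open ≡-Reasoning
    insert-remove : ∀ i → insert x (remove x X) i ≡ X i
    insert-remove i with i Fin.≟ x
    ... | yes refl rewrite =ᵛ-refl i = sym Xx
    ... | no i≢x   rewrite ≢⇒=ᵛ≡false i≢x = refl

  ⊆-or-witness : (X Y : Fin k → Bool) → X ⊆ Y ⊎ ∃[ i ] (X i ≡ true × Y i ≡ false)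
  ⊆-or-witness X Y with Fin.any? (λ i → (X i Bool.≟ true) ×-dec (Y i Bool.≟ false))
  ... | yes witness = inj₂ witness
  ... | no  none    = inj₁ λ i Xi → Bool.¬-not (λ Yi → none (i , Xi , Yi))

module _ {k : ℕ} (X : ℕ → Fin k → Bool) (increasing : ∀ t → X t ⊆ X (suc t)) where

  stabilises-or-grows : ∀ t → ∃[ T ] (X (suc T) ⊆ X T) ⊎ t ≤ card (X t)
  stabilises-or-grows zero = inj₂ z≤n
  stabilises-or-grows (suc t) with stabilises-or-grows t
  ... | inj₁ stops = inj₁ stops
  ... | inj₂ t≤card with ⊆-or-witness (X (suc t)) (X t)
  ...   | inj₁ stops           = inj₁ (t , stops)
  ...   | inj₂ (i , new , old) = inj₂ (≤-trans (s≤s t≤card) (card-mono-< (increasing t) i old new))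

  chain-stabilises : ∃[ T ] (X (suc T) ⊆ X T)
  chain-stabilises with stabilises-or-grows (suc k)
  ... | inj₁ stops  = stops
  ... | inj₂ k<card = ⊥-elim (<-irrefl refl (≤-trans k<card (card≤ (X (suc k)))))

anyᶠ : ∀ {k} → (Fin k → Bool) → Bool
anyᶠ {zero}  f = false
anyᶠ {suc k} f = f zero ∨ anyᶠ (f ∘ suc)

anyᶠ⁻ : ∀ {k} (f : Fin k → Bool) → anyᶠ f ≡ true → ∃[ i ] (f i ≡ true)
anyᶠ⁻ {suc k} f p with f zero in f₀
... | true  = zero , f₀
... | false with anyᶠ⁻ (f ∘ suc) p
...   | i , fi = suc i , fi

anyᶠ⁺ : ∀ {k} (f : Fin k → Bool) i → f i ≡ true → anyᶠ f ≡ true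
anyᶠ⁺ f zero    fi rewrite fi = refl
anyᶠ⁺ f (suc i) fi rewrite anyᶠ⁺ (f ∘ suc) i fi = Bool.∨-zeroʳ (f zero)

-- Largest subsets with a Boolean property

size≡card : ∀ {k} (V : Vec Bool k) → size V ≡ card (vlookup V)
size≡card []          = refl
size≡card (true ∷ V)  = cong suc (size≡card V)
size≡card (false ∷ V) = size≡card V

size-tabulate : ∀ {k} (X : Fin k → Bool) → size (tabulate X) ≡ card X
size-tabulate X = trans (size≡card (tabulate X)) (sum-cong-≗ (cong 𝟙 ∘ Vec.lookup∘tabulate X))

vec-ext : ∀ {k} {V W : Vec Bool k} → (∀ i → vlookup V i ≡ vlookup W i) → V ≡ W
vec-ext {V = V} {W} V≗W =
  trans (sym (Vec.tabulate∘lookup V)) (trans (Vec.tabulate-cong V≗W) (Vec.tabulate∘lookup W))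

∈-subsets : ∀ {k} (V : Vec Bool k) → V ∈ subsets k
∈-subsets []                    = here refl
∈-subsets {suc k} (true ∷ V)  = ∈-++⁺ˡ (∈-map⁺ (true ∷_) (∈-subsets V))
∈-subsets {suc k} (false ∷ V) = ∈-++⁺ʳ (map (true ∷_) (subsets k)) (∈-map⁺ (false ∷_) (∈-subsets V))

≤maxList : ∀ {x xs} → x ∈ xs → x ≤ maxList xs
≤maxList {xs = y ∷ ys} (here refl) = m≤m⊔n y (maxList ys)
≤maxList {xs = y ∷ ys} (there x∈ys) = ≤-trans (≤maxList x∈ys) (m≤n⊔m y (maxList ys))

maxList-∈ : ∀ {x xs} → x ∈ xs → maxList xs ∈ xs
maxList-∈ {x} {xs} x∈xs with foldr-selective ⊔-sel 0 xs
... | inj₂ max∈xs = max∈xs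
... | inj₁ max≡0  = subst (_∈ xs) (trans (n≤0⇒n≡0 (subst (x ≤_) max≡0 (≤maxList x∈xs))) (sym max≡0)) x∈xs

-- μ G and αAdj a unfold to maxSize (isMatchingᵇ G) and maxSize (isStableᵇ a).
maxSize : ∀ {k} → (Vec Bool k → Bool) → ℕ
maxSize {k} p = maxList (map size (filterᵇ p (subsets k)))

module _ {k : ℕ} (p : Vec Bool k → Bool) where

  size∈sizes : ∀ {V} → T (p V) → size V ∈ map size (filterᵇ p (subsets k))
  size∈sizes pV = ∈-map⁺ size (∈-filter⁺ (Bool.T? ∘ p) (∈-subsets _) pV)

  size≤maxSize : ∀ {V} → T (p V) → size V ≤ maxSize p
  size≤maxSize = ≤maxList ∘ size∈sizes

  maxSize-attained : ∀ {V} → T (p V) → ∃[ W ] (T (p W) × size W ≡ maxSize p)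
  maxSize-attained pV with ∈-map⁻ size (maxList-∈ (size∈sizes pV))
  ... | W , W∈ , max≡ = W , proj₂ (∈-filter⁻ (Bool.T? ∘ p) {xs = subsets k} W∈) , sym max≡

allᵇ⁻ : ∀ {A : Set} {p : A → Bool} {xs} → T (allᵇ p xs) → ∀ {x} → x ∈ xs → T (p x)
allᵇ⁻ {p = p} {y ∷ ys} h (here refl) with p y
... | true = tt
allᵇ⁻ {p = p} {y ∷ ys} h (there x∈ys) with p y
... | true = allᵇ⁻ h x∈ys

allᵇ⁺ : ∀ {A : Set} {p : A → Bool} xs → (∀ {x} → x ∈ xs → T (p x)) → T (allᵇ p xs)
allᵇ⁺ []                h = tt
allᵇ⁺ {p = p} (y ∷ ys) h with p y | h (here refl)
... | true | _ = allᵇ⁺ ys (h ∘ there)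

allFinᵇ⁻ : ∀ {k} {p : Fin k → Bool} → T (allᵇ p (allFin k)) → ∀ i → T (p i)
allFinᵇ⁻ {k} h i = allᵇ⁻ {xs = allFin k} h (∈-allFin i)

allFinᵇ⁺ : ∀ {k} {p : Fin k → Bool} → (∀ i → T (p i)) → T (allᵇ p (allFin k))
allFinᵇ⁺ {k} h = allᵇ⁺ (allFin k) (λ {i} _ → h i)

lookup-injective : ∀ {A : Set} {xs : List A} → AllPairs _≢_ xs → ∀ i j → lookup xs i ≡ lookup xs j → i ≡ j
lookup-injective (_ ∷ _)        zero    zero    _ = refl
lookup-injective (x≢ ∷ _)       zero    (suc j) p = ⊥-elim (All.lookup x≢ (∈-lookup j) p)
lookup-injective (x≢ ∷ _)       (suc i) zero    p = ⊥-elim (All.lookup x≢ (∈-lookup i) (sym p))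
lookup-injective (_ ∷ distinct) (suc i) (suc j) p = cong suc (lookup-injective distinct i j p)

-- Matchings and stable sets in a multigraph

-- Stability is relative to a set E of available edges, so that G − e is the same
-- multigraph with E = all-but e.
module Multigraph {n m : ℕ} (e₁ e₂ : Fin m → Fin n) (loopless : ∀ k → e₁ k ≢ e₂ k) where

  Incident : Fin n → Fin m → Set
  Incident v k = v ≡ e₁ k ⊎ v ≡ e₂ k

  Matching : (Fin m → Bool) → Set
  Matching M = ∀ k l v → M k ≡ true → M l ≡ true → Incident v k → Incident v l → k ≡ l

  Stable : (Fin m → Bool) → (Fin n → Bool) → Set
  Stable E S = ∀ k → E k ≡ true → S (e₁ k) ≡ true → S (e₂ k) ≡ true → ⊥

  Covers : (Fin m → Bool) → Fin n → Set
  Covers M v = ∃[ k ] (M k ≡ true × Incident v k)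

  covers? : ∀ M v → Dec (Covers M v)
  covers? M v = Fin.any? λ k → (M k Bool.≟ true) ×-dec ((v Fin.≟ e₁ k) ⊎-dec (v Fin.≟ e₂ k))

  matching-⊆ : ∀ {M M′} → M′ ⊆ M → Matching M → Matching M′
  matching-⊆ M′⊆M M-matching k l v M′k M′l =
    M-matching k l v (M′⊆M k M′k) (M′⊆M l M′l)

  covers-⊆ : ∀ {M M′ v} → M ⊆ M′ → Covers M v → Covers M′ v
  covers-⊆ M⊆M′ (k , Mk , vk) = k , M⊆M′ k Mk , vk

  uncovered-end⇒∉ : ∀ {M v k} → ¬ Covers M v → Incident v k → M k ≡ false
  uncovered-end⇒∉ {k = k} v-free vk = Bool.¬-not λ Mk → v-free (k , Mk , vk)

  incidence : (Fin m → Bool) → Fin n → Fin m → ℕ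
  incidence M v k = 𝟙 (M k) * (𝟙 (v =ᵛ e₁ k) + 𝟙 (v =ᵛ e₂ k))

  degree : (Fin m → Bool) → Fin n → ℕ
  degree M v = ∑[ k < m ] incidence M v k

  double-counting : ∀ M (w : Fin n → ℕ) →
    ∑[ k < m ] (𝟙 (M k) * (w (e₁ k) + w (e₂ k))) ≡ ∑[ v < n ] (w v * degree M v)
  double-counting M w = begin
    ∑[ k < m ] (𝟙 (M k) * (w (e₁ k) + w (e₂ k)))
      ≡⟨ sum-cong-≗ (λ k → cong (𝟙 (M k) *_) (sym (endpoint-sum k))) ⟩
    ∑[ k < m ] (𝟙 (M k) * ∑[ v < n ] term k v)
      ≡⟨ sum-cong-≗ (λ k → *-distribˡ-sum (𝟙 (M k)) (term k)) ⟩
    ∑[ k < m ] ∑[ v < n ] (𝟙 (M k) * term k v)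
      ≡⟨ ∑-comm (λ k v → 𝟙 (M k) * term k v) ⟩
    ∑[ v < n ] ∑[ k < m ] (𝟙 (M k) * term k v)
      ≡⟨ sum-cong-≗ (λ v → sum-cong-≗ (λ k → regroup (𝟙 (M k)) (𝟙 (v =ᵛ e₁ k)) (𝟙 (v =ᵛ e₂ k)) (w v))) ⟩
    ∑[ v < n ] ∑[ k < m ] (w v * incidence M v k)
      ≡⟨ sum-cong-≗ (λ v → sym (*-distribˡ-sum (w v) (incidence M v))) ⟩
    ∑[ v < n ] (w v * degree M v) ∎
    where
    open ≡-Reasoning
    term : Fin m → Fin n → ℕ
    term k v = 𝟙 (v =ᵛ e₁ k) * w v + 𝟙 (v =ᵛ e₂ k) * w v
    endpoint-sum : ∀ k → ∑[ v < n ] term k v ≡ w (e₁ k) + w (e₂ k)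
    endpoint-sum k = trans (∑-distrib-+ (λ v → 𝟙 (v =ᵛ e₁ k) * w v) (λ v → 𝟙 (v =ᵛ e₂ k) * w v))
                           (cong₂ _+_ (sum-point (e₁ k) w) (sum-point (e₂ k) w))
    regroup : ∀ a d₁ d₂ x → a * (d₁ * x + d₂ * x) ≡ x * (a * (d₁ + d₂))
    regroup = solve-∀

  incidence≡1 : ∀ M {v k} → M k ≡ true → Incident v k → incidence M v k ≡ 1
  incidence≡1 M {k = k} Mk (inj₁ refl) rewrite Mk | =ᵛ-refl (e₁ k) | ≢⇒=ᵛ≡false (loopless k) = refl
  incidence≡1 M {k = k} Mk (inj₂ refl) rewrite Mk | =ᵛ-refl (e₂ k) | ≢⇒=ᵛ≡false (loopless k ∘ sym) = refl

  incidence≡0 : ∀ M {v k} → ¬ (M k ≡ true × Incident v k) → incidence M v k ≡ 0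
  incidence≡0 M {v} {k} ¬inc with M k | v Fin.≟ e₁ k | v Fin.≟ e₂ k
  ... | false | _        | _        = refl
  ... | true  | yes v≡e₁ | _        = ⊥-elim (¬inc (refl , inj₁ v≡e₁))
  ... | true  | no  _    | yes v≡e₂ = ⊥-elim (¬inc (refl , inj₂ v≡e₂))
  ... | true  | no  v≢e₁ | no  v≢e₂ rewrite ≢⇒=ᵛ≡false v≢e₁ | ≢⇒=ᵛ≡false v≢e₂ = refl

  covered⇒1≤degree : ∀ {M v} → Covers M v → 1 ≤ degree M v
  covered⇒1≤degree {M} {v} (k , Mk , vk) =
    subst (_≤ degree M v) (incidence≡1 M Mk vk) (term≤sum (incidence M v) k)

  uncovered⇒degree≡0 : ∀ {M v} → ¬ Covers M v → degree M v ≡ 0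
  uncovered⇒degree≡0 {M} uncovered = sum-zeros λ k → incidence≡0 M λ (Mk , vk) → uncovered (k , Mk , vk)

  handshake : ∀ M → ∑[ v < n ] degree M v ≡ 2 * card M
  handshake M = begin
    ∑[ v < n ] degree M v                  ≡⟨ sum-cong-≗ (λ v → sym (*-identityˡ (degree M v))) ⟩
    ∑[ v < n ] (1 * degree M v)            ≡⟨ sym (double-counting M (λ _ → 1)) ⟩
    ∑[ k < m ] (𝟙 (M k) * 2)               ≡⟨ sum-cong-≗ (λ k → *-comm (𝟙 (M k)) 2) ⟩
    ∑[ k < m ] (2 * 𝟙 (M k))               ≡⟨ sym (*-distribˡ-sum 2 (𝟙 ∘ M)) ⟩
    2 * card M                             ∎
    where open ≡-Reasoning

  module _ {M : Fin m → Bool} (M-matching : Matching M) where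

    covered⇒degree≡1 : ∀ {v} → Covers M v → degree M v ≡ 1
    covered⇒degree≡1 {v} (k , Mk , vk) = trans (sum-single (incidence M v) k others) (incidence≡1 M Mk vk)
      where
      others : ∀ l → l ≢ k → incidence M v l ≡ 0
      others l l≢k = incidence≡0 M λ (Ml , vl) → l≢k (M-matching l k v Ml Mk vl vk)

    degree≤1 : ∀ v → degree M v ≤ 1
    degree≤1 v with covers? M v
    ... | yes covered   = ≤-reflexive (covered⇒degree≡1 covered)
    ... | no  uncovered = subst (_≤ 1) (sym (uncovered⇒degree≡0 uncovered)) z≤n

    2*card≤n : 2 * card M ≤ n
    2*card≤n = subst₂ _≤_ (handshake M) (sum-ones n) (sum-mono-≤ degree≤1)

    perfect⇒2*card≡n : (∀ v → Covers M v) → 2 * card M ≡ n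
    perfect⇒2*card≡n perfect =
      trans (sym (handshake M)) (trans (sum-cong-≗ (covered⇒degree≡1 ∘ perfect)) (sum-ones n))

    2*card≡n⇒perfect : 2 * card M ≡ n → ∀ v → Covers M v
    2*card≡n⇒perfect 2*card≡n v with covers? M v
    ... | yes covered   = covered
    ... | no  uncovered = ⊥-elim (<-irrefl (trans (handshake M) 2*card≡n) degree-sum<n)
      where
      degree-sum<n : ∑[ u < n ] degree M u < n
      degree-sum<n = subst (∑[ u < n ] degree M u <_) (sum-ones n) (sum-mono-< degree≤1 v
                       (subst (_< 1) (sym (uncovered⇒degree≡0 uncovered)) ≤-refl))

  matching≤complement-of-stable : ∀ {E S M} → Stable E S → M ⊆ E → Matching M → card M ≤ card (not ∘ S)
  matching≤complement-of-stable {E} {S} {M} S-stable M⊆E M-matching = begin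
    ∑[ k < m ] 𝟙 (M k)
      ≤⟨ sum-mono-≤ edge-leaves-S ⟩
    ∑[ k < m ] (𝟙 (M k) * (𝟙 (not (S (e₁ k))) + 𝟙 (not (S (e₂ k)))))
      ≡⟨ double-counting M (𝟙 ∘ not ∘ S) ⟩
    ∑[ v < n ] (𝟙 (not (S v)) * degree M v)
      ≤⟨ sum-mono-≤ (λ v → *-monoʳ-≤ (𝟙 (not (S v))) (degree≤1 M-matching v)) ⟩
    ∑[ v < n ] (𝟙 (not (S v)) * 1)
      ≡⟨ sum-cong-≗ (λ v → *-identityʳ (𝟙 (not (S v)))) ⟩
    card (not ∘ S) ∎
    where
    open ≤-Reasoning
    edge-leaves-S : ∀ k → 𝟙 (M k) ≤ 𝟙 (M k) * (𝟙 (not (S (e₁ k))) + 𝟙 (not (S (e₂ k))))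
    edge-leaves-S k with M k in Mk
    ... | false = z≤n
    ... | true with S (e₁ k) in S₁ | S (e₂ k) in S₂
    ...   | true  | true  = ⊥-elim (S-stable k (M⊆E k Mk) S₁ S₂)
    ...   | true  | false = ≤-refl
    ...   | false | _     = s≤s z≤n

  complement≤matching : ∀ {S M} → (∀ v → S v ≡ false → Covers M v) →
                        (∀ k → M k ≡ true → ∃[ v ] (Incident v k × S v ≡ true)) →
                        card (not ∘ S) ≤ card M
  complement≤matching {S} {M} outside-covered edge-meets-S = begin
    ∑[ v < n ] 𝟙 (not (S v))
      ≤⟨ sum-mono-≤ outside-has-degree ⟩
    ∑[ v < n ] (𝟙 (not (S v)) * degree M v)
      ≡⟨ sym (double-counting M (𝟙 ∘ not ∘ S)) ⟩
    ∑[ k < m ] (𝟙 (M k) * (𝟙 (not (S (e₁ k))) + 𝟙 (not (S (e₂ k)))))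
      ≤⟨ sum-mono-≤ at-most-one-end-outside ⟩
    card M ∎
    where
    open ≤-Reasoning
    outside-has-degree : ∀ v → 𝟙 (not (S v)) ≤ 𝟙 (not (S v)) * degree M v
    outside-has-degree v with S v in Sv
    ... | true  = z≤n
    ... | false = subst (_≤ 1 * degree M v) (sym (*-identityʳ 1)) (*-monoʳ-≤ 1 (covered⇒1≤degree (outside-covered v Sv)))
    at-most-one-end-outside : ∀ k → 𝟙 (M k) * (𝟙 (not (S (e₁ k))) + 𝟙 (not (S (e₂ k)))) ≤ 𝟙 (M k)
    at-most-one-end-outside k with M k in Mk
    ... | false = z≤n
    ... | true = subst (_≤ 1) (sym (+-identityʳ _)) (one-end-outside (edge-meets-S k Mk))
      where
      one-end-outside : ∃[ v ] (Incident v k × S v ≡ true) → 𝟙 (not (S (e₁ k))) + 𝟙 (not (S (e₂ k))) ≤ 1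
      one-end-outside (_ , inj₁ refl , S₁) rewrite S₁ = 𝟙≤1 _
      one-end-outside (_ , inj₂ refl , S₂) rewrite S₂ = subst (_≤ 1) (sym (+-identityʳ _)) (𝟙≤1 _)

  stable+matching≤n : ∀ {E S M} → Stable E S → M ⊆ E → Matching M → card S + card M ≤ n
  stable+matching≤n {S = S} S-stable M⊆E M-matching =
    subst (card S + _ ≤_) (card-complement S) (+-monoʳ-≤ (card S) (matching≤complement-of-stable S-stable M⊆E M-matching))

  n≤stable+matching : ∀ {S M} → (∀ v → S v ≡ false → Covers M v) →
                      (∀ k → M k ≡ true → ∃[ v ] (Incident v k × S v ≡ true)) →
                      n ≤ card S + card M
  n≤stable+matching {S} outside-covered edge-meets-S =
    subst (_≤ card S + _) (card-complement S) (+-monoʳ-≤ (card S) (complement≤matching outside-covered edge-meets-S))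

  covers-insert⁻ : ∀ {M k v} → Covers (insert k M) v → Incident v k ⊎ Covers M v
  covers-insert⁻ {M} {k} (l , l∈ , vl) with insert⁻ k M l∈
  ... | inj₁ refl = inj₁ vl
  ... | inj₂ Ml   = inj₂ (l , Ml , vl)

  insert-matching : ∀ {M k} → Matching M → (∀ v → Incident v k → ¬ Covers M v) → Matching (insert k M)
  insert-matching {M} {k} M-matching k-free x y v x∈ y∈ vx vy with insert⁻ k M x∈ | insert⁻ k M y∈
  ... | inj₁ refl | inj₁ refl = refl
  ... | inj₁ refl | inj₂ My   = ⊥-elim (k-free v vx (y , My , vy))
  ... | inj₂ Mx   | inj₁ refl = ⊥-elim (k-free v vy (x , Mx , vx))
  ... | inj₂ Mx   | inj₂ My   = M-matching x y v Mx My vx vy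

  remove-uncovers : ∀ {M j v} → Matching M → M j ≡ true → Incident v j → ¬ Covers (remove j M) v
  remove-uncovers {M} {j} M-matching Mj vj (l , l∈ , vl) with M-matching l j _ (remove⊆ j M l l∈) Mj vl vj
  ... | refl with () ← trans (sym l∈) (remove-∉ j M)

  exchange-matching : ∀ {M j k} → Matching M → M j ≡ true →
                      (∀ v → Incident v k → ¬ Covers M v ⊎ Incident v j) → Matching (insert k (remove j M))
  exchange-matching {M} {j} M-matching Mj k-ends = insert-matching (matching-⊆ (remove⊆ j M) M-matching) k-free
    where
    k-free : ∀ v → _ → ¬ Covers (remove j M) v
    k-free v vk with k-ends v vk
    ... | inj₁ uncovered = uncovered ∘ covers-⊆ (remove⊆ j M)
    ... | inj₂ vj        = remove-uncovers M-matching Mj vj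

  card-exchange : ∀ {M : Fin m → Bool} {j k} → M j ≡ true → M k ≡ false → card (insert k (remove j M)) ≡ card M
  card-exchange {M} {j} {k} Mj Mk =
    trans (card-insert {x = k} {X = remove j M} (⊆-false (remove⊆ j M) {k} Mk)) (card-remove {x = j} {X = M} Mj)

  perfect-matching-maximal : ∀ {M M′} → Matching M′ → (∀ v → Covers M v) → M ⊆ M′ → M′ ⊆ M
  perfect-matching-maximal M′-matching perfect M⊆M′ k M′k with perfect (e₁ k)
  ... | l , Ml , e₁∈l with M′-matching k l (e₁ k) M′k (M⊆M′ l Ml) (inj₁ refl) e₁∈l
  ...   | refl = Ml

  other-end : ∀ {v k} → Incident v k → ∃[ u ] (∀ w → Incident w k → w ≡ v ⊎ w ≡ u)
  other-end {k = k} (inj₁ refl) = e₂ k , λ { _ (inj₁ w≡) → inj₁ w≡ ; _ (inj₂ w≡) → inj₂ w≡ }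
  other-end {k = k} (inj₂ refl) = e₁ k , λ { _ (inj₁ w≡) → inj₂ w≡ ; _ (inj₂ w≡) → inj₁ w≡ }

  module _ {M : Fin m → Bool} (M-matching : Matching M) (M-maximum : ∀ {M′} → Matching M′ → card M′ ≤ card M)
           (M-forced : ∀ {M′} → Matching M′ → card M′ ≡ card M → M ⊆ M′) where

    no-free-edge : ∀ k → ¬ (∀ w → Incident w k → ¬ Covers M w)
    no-free-edge k k-free = <-irrefl refl (≤-trans (≤-reflexive (sym (card-insert {x = k} {X = M} Mk)))
                                                   (M-maximum (insert-matching M-matching k-free)))
      where
      Mk : M k ≡ false
      Mk = uncovered-end⇒∉ (k-free (e₁ k) (inj₁ refl)) (inj₁ refl)

    no-exchange : ∀ {k l} → M k ≡ false → M l ≡ true → ¬ (∀ w → Incident w k → ¬ Covers M w ⊎ Incident w l)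
    no-exchange {k} {l} Mk Ml k-ends = true≢false (trans (sym l-kept) l-removed)
      where
      l-kept : insert k (remove l M) l ≡ true
      l-kept = M-forced (exchange-matching M-matching Ml k-ends) (card-exchange Ml Mk) l Ml
      l≢k : l ≢ k
      l≢k refl = true≢false (trans (sym Ml) Mk)
      l-removed : insert k (remove l M) l ≡ false
      l-removed rewrite ≢⇒=ᵛ≡false l≢k | =ᵛ-refl l = refl

    forced-maximum-covers : ∀ {v k} → Incident v k → Covers M v
    forced-maximum-covers {v} {k} vk with covers? M v | other-end vk
    ... | yes covered | _ = covered
    ... | no  v-free  | u , ends with covers? M u
    ...   | no u-free           = ⊥-elim (no-free-edge k k-free)
      where
      k-free : ∀ w → Incident w k → ¬ Covers M w
      k-free w wk with ends w wk
      ... | inj₁ refl = v-free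
      ... | inj₂ refl = u-free
    ...   | yes (l , Ml , ul) = ⊥-elim (no-exchange (uncovered-end⇒∉ v-free vk) Ml k-ends)
      where
      k-ends : ∀ w → Incident w k → ¬ Covers M w ⊎ Incident w l
      k-ends w wk with ends w wk
      ... | inj₁ refl = inj₁ v-free
      ... | inj₂ refl = inj₂ ul

-- König's theorem

module Bipartition {n m : ℕ} (e₁ e₂ : Fin m → Fin n) (loopless : ∀ k → e₁ k ≢ e₂ k)
                   (c : Fin n → Bool) (proper : ∀ k → c (e₁ k) ≢ c (e₂ k)) where

  open Multigraph e₁ e₂ loopless

  endA endB : Fin m → Fin n
  endA k = if c (e₁ k) then e₁ k else e₂ k
  endB k = if c (e₁ k) then e₂ k else e₁ k

  c-e₂ : ∀ k → c (e₂ k) ≡ not (c (e₁ k))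
  c-e₂ k = Bool.¬-not (proper k ∘ sym)

  c-endA : ∀ k → c (endA k) ≡ true
  c-endA k with c (e₁ k) in c₁
  ... | true  = c₁
  ... | false = trans (c-e₂ k) (cong not c₁)

  c-endB : ∀ k → c (endB k) ≡ false
  c-endB k with c (e₁ k) in c₁
  ... | true  = trans (c-e₂ k) (cong not c₁)
  ... | false = c₁

  endA-incident : ∀ k → Incident (endA k) k
  endA-incident k with c (e₁ k)
  ... | true  = inj₁ refl
  ... | false = inj₂ refl

  endB-incident : ∀ k → Incident (endB k) k
  endB-incident k with c (e₁ k)
  ... | true  = inj₂ refl
  ... | false = inj₁ refl

  incident⇒endA⊎endB : ∀ {v k} → Incident v k → v ≡ endA k ⊎ v ≡ endB k
  incident⇒endA⊎endB {k = k} vk with c (e₁ k) | vk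
  ... | true  | inj₁ v≡e₁ = inj₁ v≡e₁
  ... | true  | inj₂ v≡e₂ = inj₂ v≡e₂
  ... | false | inj₁ v≡e₁ = inj₂ v≡e₁
  ... | false | inj₂ v≡e₂ = inj₁ v≡e₂

  stable-by-ends : ∀ {E S} → (∀ k → E k ≡ true → S (endA k) ≡ true → S (endB k) ≡ true → ⊥) → Stable E S
  stable-by-ends by-ends k Ek S₁ S₂ with c (e₁ k) | by-ends k Ek
  ... | true  | no-edge = no-edge S₁ S₂
  ... | false | no-edge = no-edge S₂ S₁

  module Alternating (E M : Fin m → Bool) (M⊆E : M ⊆ E) (M-matching : Matching M) where

    neighbours : (Fin n → Bool) → Fin n → Bool
    neighbours X b = anyᶠ λ k → E k ∧ (endB k =ᵛ b) ∧ X (endA k)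

    -- reach t: the vertices of A joined to an M-free vertex of A by an M-alternating path
    -- through at most t edges of M.
    reach : ℕ → Fin n → Bool
    reach zero    v = c v ∧ not (does (covers? M v))
    reach (suc t) v = reach t v ∨ anyᶠ λ j → M j ∧ (endA j =ᵛ v) ∧ neighbours (reach t) (endB j)

    neighbours⁻ : ∀ {X b} → neighbours X b ≡ true → ∃[ k ] (E k ≡ true × endB k ≡ b × X (endA k) ≡ true)
    neighbours⁻ p with anyᶠ⁻ _ p
    ... | k , q with ∧-true q
    ...   | Ek , r with ∧-true r
    ...     | b≡ , Xa = k , Ek , =ᵛ⇒≡ b≡ , Xa

    neighbours⁺ : ∀ {X k} → E k ≡ true → X (endA k) ≡ true → neighbours X (endB k) ≡ true
    neighbours⁺ {X} {k} Ek Xa = anyᶠ⁺ _ k (subst₂ (λ e x → e ∧ (endB k =ᵛ endB k) ∧ x ≡ true) (sym Ek) (sym Xa)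
                                                  (cong (_∧ true) (=ᵛ-refl (endB k))))

    reach-mono : ∀ t → reach t ⊆ reach (suc t)
    reach-mono t v p rewrite p = refl

    reach₀⊆ : ∀ t → reach 0 ⊆ reach t
    reach₀⊆ zero    v p = p
    reach₀⊆ (suc t) v p = reach-mono t v (reach₀⊆ t v p)

    reach₀⁺ : ∀ {v} → c v ≡ true → ¬ Covers M v → reach 0 v ≡ true
    reach₀⁺ {v} cv uncovered rewrite cv | dec-false (covers? M v) uncovered = refl

    reach₀⁻ : ∀ {v} → reach 0 v ≡ true → ¬ Covers M v
    reach₀⁻ {v} p covered with covers? M v | p
    ... | no uncovered | _ = uncovered covered
    ... | yes _        | q rewrite Bool.∧-zeroʳ (c v) with () ← q

    reach-step⁻ : ∀ {t a} → reach (suc t) a ≡ true →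
                  reach t a ≡ true ⊎ ∃[ j ] (M j ≡ true × endA j ≡ a × neighbours (reach t) (endB j) ≡ true)
    reach-step⁻ {t} {a} p with reach t a
    ... | true  = inj₁ refl
    ... | false with anyᶠ⁻ _ p
    ...   | j , q with ∧-true q
    ...     | Mj , r with ∧-true r
    ...       | a≡ , nb = inj₂ (j , Mj , =ᵛ⇒≡ a≡ , nb)

    reach-step⁺ : ∀ {t j} → M j ≡ true → neighbours (reach t) (endB j) ≡ true → reach (suc t) (endA j) ≡ true
    reach-step⁺ {t} {j} Mj nb with reach t (endA j)
    ... | true  = refl
    ... | false = anyᶠ⁺ _ j (subst₂ (λ x y → x ∧ (endA j =ᵛ endA j) ∧ y ≡ true) (sym Mj) (sym nb)
                                    (cong (_∧ true) (=ᵛ-refl (endA j))))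

    -- Instead of the alternating path to a, keep the matching obtained by switching along it.
    record Avoiding (t : ℕ) (a : Fin n) : Set where
      field
        M′          : Fin m → Bool
        M′⊆E        : M′ ⊆ E
        M′-matching : Matching M′
        card≡       : card M′ ≡ card M
        avoids      : ¬ Covers M′ a
        B-covered   : ∀ y → c y ≡ false → Covers M′ y → Covers M y
        keeps       : ∀ j → M j ≡ true → reach t (endA j) ≡ false → M′ j ≡ true

    avoiding-M : ∀ {a} → reach 0 a ≡ true → Avoiding 0 a
    avoiding-M r = record
      { M′ = M ; M′⊆E = M⊆E ; M′-matching = M-matching ; card≡ = refl
      ; avoids = reach₀⁻ r ; B-covered = λ _ _ covered → covered ; keeps = λ _ Mj _ → Mj }

    avoiding-suc : ∀ {t a} → Avoiding t a → Avoiding (suc t) a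
    avoiding-suc {t} A = record
      { M′ = M′ ; M′⊆E = M′⊆E ; M′-matching = M′-matching ; card≡ = card≡
      ; avoids = avoids ; B-covered = B-covered
      ; keeps = λ j Mj r → keeps j Mj (⊆-false (reach-mono t) r) }
      where open Avoiding A

    avoiding-step : ∀ {t j k} → reach t (endA k) ≡ true → Avoiding t (endA k) → M j ≡ true → E k ≡ true →
                    endB k ≡ endB j → reach t (endA j) ≡ false → reach (suc t) (endA j) ≡ true →
                    Avoiding (suc t) (endA j)
    avoiding-step {t} {j} {k} rk A Mj Ek bk≡bj r-old r-new = record
      { M′ = M″ ; M′⊆E = insert-⊆ Ek (⊆-trans (remove⊆ j M′) M′⊆E)
      ; M′-matching = exchange-matching M′-matching M′j k-ends
      ; card≡ = trans (card-exchange M′j M′k) card≡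
      ; avoids = avoids″ ; B-covered = B-covered″ ; keeps = keeps″ }
      where
      open Avoiding A
      M″ = insert k (remove j M′)
      M′j : M′ j ≡ true
      M′j = keeps j Mj r-old
      M′k : M′ k ≡ false
      M′k = uncovered-end⇒∉ avoids (endA-incident k)
      endB-k∈j : Incident (endB k) j
      endB-k∈j = subst (λ v → Incident v j) (sym bk≡bj) (endB-incident j)
      k-ends : ∀ v → Incident v k → ¬ Covers M′ v ⊎ Incident v j
      k-ends v vk with incident⇒endA⊎endB vk
      ... | inj₁ refl = inj₁ avoids
      ... | inj₂ refl = inj₂ endB-k∈j
      avoids″ : ¬ Covers M″ (endA j)
      avoids″ covered with covers-insert⁻ covered
      ... | inj₂ covered′ = remove-uncovers M′-matching M′j (endA-incident j) covered′
      ... | inj₁ a∈k with incident⇒endA⊎endB a∈k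
      ...   | inj₁ a≡ = true≢false (trans (sym rk) (trans (cong (reach t) (sym a≡)) r-old))
      ...   | inj₂ a≡ = true≢false (trans (sym (c-endA j)) (trans (cong c a≡) (c-endB k)))
      B-covered″ : ∀ y → c y ≡ false → Covers M″ y → Covers M y
      B-covered″ y cy covered with covers-insert⁻ covered
      ... | inj₂ covered′ = B-covered y cy (covers-⊆ (remove⊆ j M′) covered′)
      ... | inj₁ y∈k with incident⇒endA⊎endB y∈k
      ...   | inj₁ refl = ⊥-elim (true≢false (trans (sym (c-endA k)) cy))
      ...   | inj₂ refl = j , Mj , endB-k∈j
      keeps″ : ∀ i → M i ≡ true → reach (suc t) (endA i) ≡ false → M″ i ≡ true
      keeps″ i Mi r with i Fin.≟ k | i Fin.≟ j
      ... | yes refl | _        = insert-∈ k (remove j M′)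
      ... | no _     | yes refl = ⊥-elim (true≢false (trans (sym r-new) r))
      ... | no i≢k   | no i≢j   =
        ⊆-insert k (remove j M′) i (remove⁺ {X = M′} i≢j (keeps i Mi (⊆-false (reach-mono t) r)))

    reach⇒avoiding : ∀ t a → reach t a ≡ true → Avoiding t a
    reach⇒avoiding zero    a r = avoiding-M r
    reach⇒avoiding (suc t) a r with reach t a in r-old | reach-step⁻ {t} r
    ... | true  | _ = avoiding-suc (reach⇒avoiding t a r-old)
    ... | false | inj₁ ()
    ... | false | inj₂ (j , Mj , refl , nb) with neighbours⁻ {reach t} nb
    ...   | k , Ek , bk≡bj , rk = avoiding-step rk (reach⇒avoiding t (endA k) rk) Mj Ek bk≡bj r-old r

    Augmentation : Set
    Augmentation = ∃[ M′ ] (M′ ⊆ E × Matching M′ × card M < card M′)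

    Certificate : Set
    Certificate = ∃[ S ] (Stable E S × n ≤ card S + card M)

    augment : ∀ {t b} → c b ≡ false → neighbours (reach t) b ≡ true → ¬ Covers M b → Augmentation
    augment {t} cb nb b-free with neighbours⁻ {reach t} nb
    ... | k , Ek , refl , rk = insert k M′ , insert-⊆ Ek M′⊆E , insert-matching M′-matching k-free , card<
      where
      open Avoiding (reach⇒avoiding t (endA k) rk)
      k-free : ∀ v → Incident v k → ¬ Covers M′ v
      k-free v vk with incident⇒endA⊎endB vk
      ... | inj₁ refl = avoids
      ... | inj₂ refl = b-free ∘ B-covered (endB k) cb
      card< : card M < card (insert k M′)
      card< = subst (card M <_) (sym (trans (card-insert {x = k} {X = M′} (uncovered-end⇒∉ avoids (endA-incident k)))
                                            (cong suc card≡))) ≤-refl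

    certify : ∀ {t} → reach (suc t) ⊆ reach t →
              (∀ b → c b ≡ false → neighbours (reach t) b ≡ true → Covers M b) → Certificate
    certify {t} closed saturated = S , stable-by-ends {E} {S} S-stable , n≤stable+matching outside-covered edge-meets-S
      where
      R = reach t
      -- the complement of König's vertex cover (A ∖ R) ∪ N(R)
      S : Fin n → Bool
      S v = if c v then R v else not (neighbours R v)
      S-endA : ∀ k → S (endA k) ≡ R (endA k)
      S-endA k rewrite c-endA k = refl
      S-endB : ∀ k → S (endB k) ≡ not (neighbours R (endB k))
      S-endB k rewrite c-endB k = refl
      S-stable : ∀ k → E k ≡ true → S (endA k) ≡ true → S (endB k) ≡ true → ⊥
      S-stable k Ek Sa Sb =
        true≢false (trans (sym Sb) (trans (S-endB k) (cong not (neighbours⁺ {R} Ek (trans (sym (S-endA k)) Sa)))))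
      outside-covered : ∀ v → S v ≡ false → Covers M v
      outside-covered v Sv with c v in cv | covers? M v
      ... | _     | yes covered   = covered
      ... | true  | no  uncovered = ⊥-elim (true≢false (trans (sym (reach₀⊆ t v (reach₀⁺ cv uncovered))) Sv))
      ... | false | no  uncovered = saturated v cv (Bool.not-injective Sv)
      edge-meets-S : ∀ j → M j ≡ true → ∃[ v ] (Incident v j × S v ≡ true)
      edge-meets-S j Mj with neighbours R (endB j) in nb
      ... | true  = endA j , endA-incident j , trans (S-endA j) (closed (endA j) (reach-step⁺ {t} Mj nb))
      ... | false = endB j , endB-incident j , trans (S-endB j) (cong not nb)

    augment-or-certify : Augmentation ⊎ Certificate
    augment-or-certify with chain-stabilises reach reach-mono
    ... | t , closed
      with Fin.any? (λ b → (c b Bool.≟ false) ×-dec (neighbours (reach t) b Bool.≟ true) ×-dec ¬? (covers? M b))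
    ...   | yes (b , cb , nb , b-free) = inj₁ (augment {t} cb nb b-free)
    ...   | no  no-free-b = inj₂ (certify {t} closed saturated)
      where
      saturated : ∀ b → c b ≡ false → neighbours (reach t) b ≡ true → Covers M b
      saturated b cb nb with covers? M b
      ... | yes covered   = covered
      ... | no  uncovered = ⊥-elim (no-free-b (b , cb , nb , uncovered))

  könig : ∀ E → ∃[ S ] ∃[ M ] (Stable E S × M ⊆ E × Matching M × n ≤ card S + card M)
  könig E = improve m (λ _ → false) (λ _ ()) (λ _ _ _ ()) (m≤n+m m _)
    where
    -- card M ≤ m grows with every augmentation, so m rounds suffice.
    improve : ∀ fuel M → M ⊆ E → Matching M → m ≤ card M + fuel →
              ∃[ S ] ∃[ M ] (Stable E S × M ⊆ E × Matching M × n ≤ card S + card M)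
    improve fuel M M⊆E M-matching bound with Alternating.augment-or-certify E M M⊆E M-matching
    ... | inj₂ (S , S-stable , n≤) = S , M , S-stable , M⊆E , M-matching , n≤
    ... | inj₁ (M′ , M′⊆E , M′-matching , card<) with fuel
    ...   | zero     =
      ⊥-elim (<-irrefl refl (≤-<-trans (subst (m ≤_) (+-identityʳ _) bound) (<-≤-trans card< (card≤ M′))))
    ...   | suc fuel =
      improve fuel M′ M′⊆E M′-matching (≤-trans bound (≤-trans (≤-reflexive (+-suc _ fuel)) (+-monoˡ-≤ fuel card<)))

-- A graph as a multigraph on its edge list

module _ {k : ℕ} where

  shared⇒¬disjointᵇ : ∀ {a b c d u : Fin k} → (u ≡ a ⊎ u ≡ b) → (u ≡ c ⊎ u ≡ d) →
                      disjointᵇ (a , b) (c , d) ≡ false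
  shared⇒¬disjointᵇ {u = u}         (inj₁ refl) (inj₁ refl) rewrite =ᵛ-refl u = refl
  shared⇒¬disjointᵇ {c = c} {u = u} (inj₁ refl) (inj₂ refl) rewrite =ᵛ-refl u | Bool.∨-zeroʳ (u =ᵛ c) = refl
  shared⇒¬disjointᵇ {a} {d = d} {u}  (inj₂ refl) (inj₁ refl)
    rewrite =ᵛ-refl u | Bool.∨-zeroʳ (a =ᵛ d) | Bool.∨-zeroʳ (a =ᵛ u) = refl
  shared⇒¬disjointᵇ {a} {c = c} {u = u} (inj₂ refl) (inj₂ refl)
    rewrite =ᵛ-refl u | Bool.∨-zeroʳ (u =ᵛ c) | Bool.∨-zeroʳ (a =ᵛ u) | Bool.∨-zeroʳ (a =ᵛ c) = refl

  ¬disjointᵇ⇒shared : ∀ (a b c d : Fin k) → disjointᵇ (a , b) (c , d) ≡ false →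
                      ∃[ u ] ((u ≡ a ⊎ u ≡ b) × (u ≡ c ⊎ u ≡ d))
  ¬disjointᵇ⇒shared a b c d p with a Fin.≟ c | a Fin.≟ d | b Fin.≟ c | b Fin.≟ d
  ... | yes a≡c | _       | _       | _       = a , inj₁ refl , inj₁ a≡c
  ... | no _    | yes a≡d | _       | _       = a , inj₁ refl , inj₂ a≡d
  ... | no _    | no _    | yes b≡c | _       = b , inj₂ refl , inj₁ b≡c
  ... | no _    | no _    | no _    | yes b≡d = b , inj₂ refl , inj₂ b≡d
  ... | no a≢c  | no a≢d  | no b≢c  | no b≢d
    rewrite ≢⇒=ᵛ≡false a≢c | ≢⇒=ᵛ≡false a≢d | ≢⇒=ᵛ≡false b≢c | ≢⇒=ᵛ≡false b≢d with () ← p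

  incident⁺ : ∀ {v x y : Fin k} → v ≡ x ⊎ v ≡ y → T ((v =ᵛ x) ∨ (v =ᵛ y))
  incident⁺ {v} (inj₁ refl) rewrite =ᵛ-refl v = tt
  incident⁺ {v} {x} (inj₂ refl) rewrite =ᵛ-refl v | Bool.∨-zeroʳ (v =ᵛ x) = tt

  incident⁻ : ∀ {v x y : Fin k} → T ((v =ᵛ x) ∨ (v =ᵛ y)) → v ≡ x ⊎ v ≡ y
  incident⁻ {v} {x} {y} p with v =ᵛ x in v=x | v =ᵛ y in v=y
  ... | true  | _    = inj₁ (=ᵛ⇒≡ v=x)
  ... | false | true = inj₂ (=ᵛ⇒≡ v=y)

  isStable⁻ : ∀ (a : Fin k → Fin k → Bool) S → T (isStableᵇ a S) →
              ∀ i j → a i j ≡ true → vlookup S i ≡ true → vlookup S j ≡ true → ⊥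
  isStable⁻ a S stable i j aij Si Sj with allFinᵇ⁻ (allFinᵇ⁻ stable i) j
  ... | p rewrite aij | Si | Sj = p

  isStable⁺ : ∀ (a : Fin k → Fin k → Bool) X → (∀ i j → a i j ≡ true → X i ≡ true → X j ≡ true → ⊥) →
              T (isStableᵇ a (tabulate X))
  isStable⁺ a X stable = allFinᵇ⁺ λ i → allFinᵇ⁺ λ j → pair i j
    where
    pair : ∀ i j → T (not (vlookup (tabulate X) i ∧ vlookup (tabulate X) j ∧ a i j))
    pair i j rewrite Vec.lookup∘tabulate X i | Vec.lookup∘tabulate X j with X i in Xi | X j in Xj | a i j in aij
    ... | false | _     | _     = tt
    ... | true  | false | _     = tt
    ... | true  | true  | false = tt
    ... | true  | true  | true  = stable i j aij Xi Xj

  α-upper : ∀ (a : Fin k → Fin k → Bool) S → T (isStableᵇ a S) → size S ≤ αAdj a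
  α-upper a S = size≤maxSize (isStableᵇ a) {S}

  α-attained : ∀ (a : Fin k → Fin k → Bool) → ∃[ S ] (T (isStableᵇ a S) × size S ≡ αAdj a)
  α-attained a = maxSize-attained (isStableᵇ a) {tabulate λ _ → false} (isStable⁺ a (λ _ → false) λ _ _ _ ())

has-neighbour : ∀ {G} → Connected G → HasEdge G → ∀ v → ∃[ u ] (adj G v u ≡ true)
has-neighbour {G} connected (u₀ , v₀ , u₀v₀) v with v Fin.≟ u₀
... | yes refl = v₀ , u₀v₀
... | no  v≢u₀ = first-step (connected v u₀) v≢u₀
  where
  first-step : ∀ {x y} → Reach G x y → x ≢ y → ∃[ u ] (adj G x u ≡ true)
  first-step here              x≢x = ⊥-elim (x≢x refl)
  first-step (step {w = w} xw _) _ = w , xw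

module Edges (G : Graph) where

  e₁ e₂ : Fin (m G) → Fin (n G)
  e₁ k = proj₁ (edge G k)
  e₂ k = proj₂ (edge G k)

  private
    listed : Fin (n G) × Fin (n G) → Bool
    listed (u , v) = (toℕ u <ᵇ toℕ v) ∧ adj G u v

    edge-listed : ∀ k → listed (edge G k) ≡ true
    edge-listed k = Equivalence.to Bool.T-≡
      (proj₂ (∈-filter⁻ (Bool.T? ∘ listed) {xs = cartesianProduct (allFin (n G)) (allFin (n G))} (∈-lookup k)))

  e₁<e₂ : ∀ k → toℕ (e₁ k) < toℕ (e₂ k)
  e₁<e₂ k = <ᵇ⇒< _ _ (Equivalence.from Bool.T-≡ (proj₁ (∧-true (edge-listed k))))

  edge-adjacent : ∀ k → adj G (e₁ k) (e₂ k) ≡ true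
  edge-adjacent k = proj₂ (∧-true (edge-listed k))

  loopless : ∀ k → e₁ k ≢ e₂ k
  loopless k e₁≡e₂ = <-irrefl (cong toℕ e₁≡e₂) (e₁<e₂ k)

  edge-injective : ∀ {k l} → edge G k ≡ edge G l → k ≡ l
  edge-injective = lookup-injective (Unique.filter⁺ (Bool.T? ∘ listed)
    (Unique.cartesianProduct⁺ (Unique.allFin⁺ (n G)) (Unique.allFin⁺ (n G)))) _ _

  ordered-adjacent⇒edge : ∀ {u v} → toℕ u < toℕ v → adj G u v ≡ true → ∃[ k ] (e₁ k ≡ u × e₂ k ≡ v)
  ordered-adjacent⇒edge {u} {v} u<v uv
    with ∈-filter⁺ (Bool.T? ∘ listed) (∈-cartesianProduct⁺ (∈-allFin u) (∈-allFin v))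
                   (Equivalence.from Bool.T-≡ (cong₂ _∧_ (Equivalence.to Bool.T-≡ (<⇒<ᵇ u<v)) uv))
  ... | uv∈edges =
    Any.index uv∈edges , cong proj₁ (sym (lookup-index uv∈edges)) , cong proj₂ (sym (lookup-index uv∈edges))

  adjacent⇒edge : ∀ {u v} → adj G u v ≡ true → ∃[ k ] ((e₁ k ≡ u × e₂ k ≡ v) ⊎ (e₁ k ≡ v × e₂ k ≡ u))
  adjacent⇒edge {u} {v} uv with <-cmp (toℕ u) (toℕ v)
  ... | tri< u<v _ _ = let k , ends = ordered-adjacent⇒edge u<v uv in k , inj₁ ends
  ... | tri> _ _ v<u = let k , ends = ordered-adjacent⇒edge v<u (trans (adjSym G v u) uv) in k , inj₂ ends
  ... | tri≈ _ u≡v _ =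
    ⊥-elim (true≢false (trans (sym uv) (trans (cong (adj G u) (sym (Fin.toℕ-injective u≡v))) (adjIrr G u))))

  open Multigraph e₁ e₂ loopless public

  incident-edge : Connected G → HasEdge G → ∀ v → ∃[ k ] Incident v k
  incident-edge connected has-edge v with adjacent⇒edge (proj₂ (has-neighbour connected has-edge v))
  ... | k , inj₁ (refl , _) = k , inj₁ refl
  ... | k , inj₂ (_ , refl) = k , inj₂ refl

  all-edges : Fin (m G) → Bool
  all-edges _ = true

  all-but : Fin (m G) → Fin (m G) → Bool
  all-but k l = not (l =ᵛ k)

  isMatching⇒Matching : ∀ V → IsMatching G V → Matching (vlookup V)
  isMatching⇒Matching V matching k l v Vk Vl vk vl with k Fin.≟ l
  ... | yes k≡l = k≡l
  ... | no  k≢l with allFinᵇ⁻ (allFinᵇ⁻ matching k) l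
  ...   | pair rewrite Vk | Vl | ≢⇒=ᵛ≡false k≢l | shared⇒¬disjointᵇ vk vl = ⊥-elim pair

  Matching⇒isMatching : ∀ {X} → Matching X → IsMatching G (tabulate X)
  Matching⇒isMatching {X} matching = allFinᵇ⁺ λ k → allFinᵇ⁺ λ l → pair k l
    where
    pair : ∀ k l → T (not (vlookup (tabulate X) k ∧ vlookup (tabulate X) l ∧ not (toℕ k ≡ᵇ toℕ l))
                      ∨ disjointᵇ (edge G k) (edge G l))
    pair k l rewrite Vec.lookup∘tabulate X k | Vec.lookup∘tabulate X l
      with X k in Xk | X l in Xl | k Fin.≟ l
    ... | false | _     | _       = tt
    ... | true  | false | _       = tt
    ... | true  | true  | yes refl rewrite =ᵛ-refl k = tt
    ... | true  | true  | no  k≢l rewrite ≢⇒=ᵛ≡false k≢l with disjointᵇ (edge G k) (edge G l) in disjoint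
    ...   | true  = tt
    ...   | false with ¬disjointᵇ⇒shared (e₁ k) (e₂ k) (e₁ l) (e₂ l) disjoint
    ...     | v , vk , vl = k≢l (matching k l v Xk Xl vk vl)

  isStable⇒Stable : ∀ S → T (isStableᵇ (adj G) S) → Stable all-edges (vlookup S)
  isStable⇒Stable S stable k _ = isStable⁻ (adj G) S stable (e₁ k) (e₂ k) (edge-adjacent k)

  Stable⇒isStable : ∀ {X} → Stable all-edges X → T (isStableᵇ (adj G) (tabulate X))
  Stable⇒isStable {X} stable = isStable⁺ (adj G) X no-edge
    where
    no-edge : ∀ u v → adj G u v ≡ true → X u ≡ true → X v ≡ true → ⊥
    no-edge u v uv Xu Xv with adjacent⇒edge uv
    ... | k , inj₁ (refl , refl) = stable k refl Xu Xv
    ... | k , inj₂ (refl , refl) = stable k refl Xv Xu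

  all-but⇒≢ : ∀ {k l} → all-but k l ≡ true → l ≢ k
  all-but⇒≢ {k} l≠k refl = true≢false (trans (sym l≠k) (cong not (=ᵛ-refl k)))

  ≢⇒all-but : ∀ {k l} → l ≢ k → all-but k l ≡ true
  ≢⇒all-but l≢k = cong not (≢⇒=ᵛ≡false l≢k)

  not-same-edge : ∀ {k l} → l ≢ k → (e₁ l =ᵛ e₁ k) ∧ (e₂ l =ᵛ e₂ k) ≡ false
  not-same-edge {k} {l} l≢k with e₁ l =ᵛ e₁ k in p | e₂ l =ᵛ e₂ k in q
  ... | false | _     = refl
  ... | true  | false = refl
  ... | true  | true  = ⊥-elim (l≢k (edge-injective (cong₂ _,_ (=ᵛ⇒≡ p) (=ᵛ⇒≡ q))))

  not-reversed-edge : ∀ k l → (e₁ l =ᵛ e₂ k) ∧ (e₂ l =ᵛ e₁ k) ≡ false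
  not-reversed-edge k l with e₁ l =ᵛ e₂ k in p | e₂ l =ᵛ e₁ k in q
  ... | false | _     = refl
  ... | true  | false = refl
  ... | true  | true  =
    ⊥-elim (<-asym (subst₂ _<_ (cong toℕ (=ᵛ⇒≡ p)) (cong toℕ (=ᵛ⇒≡ q)) (e₁<e₂ l)) (e₁<e₂ k))

  delEdge-keeps : ∀ {k l} → l ≢ k → delEdge G (edge G k) (e₁ l) (e₂ l) ≡ true
  delEdge-keeps {k} {l} l≢k rewrite edge-adjacent l | not-same-edge l≢k | not-reversed-edge k l = refl

  delEdge-removes : ∀ k → delEdge G (edge G k) (e₁ k) (e₂ k) ≡ false × delEdge G (edge G k) (e₂ k) (e₁ k) ≡ false
  delEdge-removes k rewrite =ᵛ-refl (e₁ k) | =ᵛ-refl (e₂ k)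
    | Bool.∨-zeroʳ (e₂ k =ᵛ e₁ k ∧ e₁ k =ᵛ e₂ k) | Bool.∧-zeroʳ (adj G (e₂ k) (e₁ k)) = Bool.∧-zeroʳ _ , refl

  isStable-delEdge⇒Stable : ∀ {k} S → T (isStableᵇ (delEdge G (edge G k)) S) → Stable (all-but k) (vlookup S)
  isStable-delEdge⇒Stable {k} S stable l l≠k =
    isStable⁻ (delEdge G (edge G k)) S stable (e₁ l) (e₂ l) (delEdge-keeps (all-but⇒≢ l≠k))

  Stable⇒isStable-delEdge : ∀ {k X} → Stable (all-but k) X → T (isStableᵇ (delEdge G (edge G k)) (tabulate X))
  Stable⇒isStable-delEdge {k} {X} stable = isStable⁺ (delEdge G (edge G k)) X no-edge
    where
    no-edge : ∀ u v → delEdge G (edge G k) u v ≡ true → X u ≡ true → X v ≡ true → ⊥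
    no-edge u v uv Xu Xv with adjacent⇒edge (proj₁ (∧-true uv))
    ... | l , ends with l Fin.≟ k | ends
    ...   | yes refl | inj₁ (refl , refl) = true≢false (trans (sym uv) (proj₁ (delEdge-removes k)))
    ...   | yes refl | inj₂ (refl , refl) = true≢false (trans (sym uv) (proj₂ (delEdge-removes k)))
    ...   | no  l≢k  | inj₁ (refl , refl) = stable l (≢⇒all-but l≢k) Xu Xv
    ...   | no  l≢k  | inj₂ (refl , refl) = stable l (≢⇒all-but l≢k) Xv Xu

  covers⇒Covers : ∀ {V v} → covers G V v → Covers (vlookup V) v
  covers⇒Covers (k , Vk , vk) = k , Vk , incident⁻ vk

  Covers⇒covers : ∀ {V v} → Covers (vlookup V) v → covers G V v
  Covers⇒covers (k , Vk , vk) = k , Vk , incident⁺ vk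

  μ-upper : ∀ V → IsMatching G V → size V ≤ μ G
  μ-upper V = size≤maxSize (isMatchingᵇ G) {V}

  μ-attained : ∃[ V ] (IsMatching G V × size V ≡ μ G)
  μ-attained = maxSize-attained (isMatchingᵇ G) {tabulate λ _ → false} (Matching⇒isMatching λ _ _ _ ())

-- Critical edges of a bipartite graph

module BipartiteGraph (G : Graph) (bipartite : Bipartite G) where

  open Edges G

  colour-proper : ∀ k → proj₁ bipartite (e₁ k) ≢ proj₁ bipartite (e₂ k)
  colour-proper k = proj₂ bipartite (e₁ k) (e₂ k) (edge-adjacent k)

  open Bipartition e₁ e₂ loopless (proj₁ bipartite) colour-proper using (könig)

  IsMaximum : EdgeSet G → Set
  IsMaximum V = IsMatching G V × size V ≡ μ G

  α⁻ : Fin (m G) → ℕ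
  α⁻ k = αAdj (delEdge G (edge G k))

  card≤μ : ∀ {X} → Matching X → card X ≤ μ G
  card≤μ {X} X-matching = subst (_≤ μ G) (size-tabulate X) (μ-upper (tabulate X) (Matching⇒isMatching X-matching))

  card≤α : ∀ {X} → Stable all-edges X → card X ≤ α G
  card≤α {X} X-stable = subst (_≤ α G) (size-tabulate X) (α-upper (adj G) (tabulate X) (Stable⇒isStable X-stable))

  card≤α⁻ : ∀ {k X} → Stable (all-but k) X → card X ≤ α⁻ k
  card≤α⁻ {k} {X} X-stable = subst (_≤ α⁻ k) (size-tabulate X)
    (α-upper (delEdge G (edge G k)) (tabulate X) (Stable⇒isStable-delEdge X-stable))

  α+μ≡n : α G + μ G ≡ n G
  α+μ≡n = ≤-antisym α+μ≤n n≤α+μ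
    where
    α+μ≤n : α G + μ G ≤ n G
    α+μ≤n with α-attained (adj G) | μ-attained
    ... | S , S-stable , |S|≡α | V , V-matching , |V|≡μ =
      subst₂ (λ a b → a + b ≤ n G) (trans (sym (size≡card S)) |S|≡α) (trans (sym (size≡card V)) |V|≡μ)
        (stable+matching≤n (isStable⇒Stable S S-stable) (λ _ _ → refl) (isMatching⇒Matching V V-matching))
    n≤α+μ : n G ≤ α G + μ G
    n≤α+μ with könig all-edges
    ... | S , M , S-stable , _ , M-matching , n≤ = ≤-trans n≤ (+-mono-≤ (card≤α S-stable) (card≤μ M-matching))

  2μ≤n : 2 * μ G ≤ n G
  2μ≤n with μ-attained
  ... | V , V-matching , |V|≡μ =
    subst (λ x → 2 * x ≤ n G) (trans (sym (size≡card V)) |V|≡μ) (2*card≤n (isMatching⇒Matching V V-matching))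

  μ≤α : μ G ≤ α G
  μ≤α = +-cancelʳ-≤ (μ G) (μ G) (α G) (subst₂ _≤_ (cong (μ G +_) (+-identityʳ (μ G))) (sym α+μ≡n) 2μ≤n)

  critical⊆maximum : ∀ V → IsMaximum V → isCriticalᵇ G ⊆ vlookup V
  critical⊆maximum V (V-matching , |V|≡μ) k critical with vlookup V k in Vk
  ... | true  = refl
  ... | false with α-attained (delEdge G (edge G k))
  ...   | S , S-stable , |S|≡α⁻ = ⊥-elim (<⇒≱ α<α⁻ (+-cancelʳ-≤ (μ G) (α⁻ k) (α G) α⁻+μ≤α+μ))
    where
    α<α⁻ : α G < α⁻ k
    α<α⁻ = <ᵇ⇒< (α G) (α⁻ k) (Equivalence.from Bool.T-≡ critical)
    V⊆all-but : vlookup V ⊆ all-but k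
    V⊆all-but l Vl = ≢⇒all-but {k} {l} λ { refl → true≢false (trans (sym Vl) Vk) }
    α⁻+μ≤α+μ : α⁻ k + μ G ≤ α G + μ G
    α⁻+μ≤α+μ = subst₂ _≤_ (cong₂ _+_ (trans (sym (size≡card S)) |S|≡α⁻) (trans (sym (size≡card V)) |V|≡μ))
                          (sym α+μ≡n)
                 (stable+matching≤n (isStable-delEdge⇒Stable S S-stable) V⊆all-but (isMatching⇒Matching V V-matching))

  in-every-maximum⇒critical : ∀ {k} → (∀ V → IsMaximum V → vlookup V k ≡ true) → isCriticalᵇ G k ≡ true
  in-every-maximum⇒critical {k} forced with könig (all-but k)
  ... | S , M , S-stable , M⊆all-but , M-matching , n≤ = Equivalence.to Bool.T-≡ (<⇒<ᵇ α<α⁻)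
    where
    M-not-maximum : card M ≢ μ G
    M-not-maximum |M|≡μ = all-but⇒≢ {k} (M⊆all-but k Mk) refl
      where
      Mk : M k ≡ true
      Mk = trans (sym (Vec.lookup∘tabulate M k))
                 (forced (tabulate M) (Matching⇒isMatching M-matching , trans (size-tabulate M) |M|≡μ))
    α<α⁻ : α G < α⁻ k
    α<α⁻ = +-cancelʳ-< (μ G) (α G) (α⁻ k) (begin-strict
      α G + μ G          ≡⟨ α+μ≡n ⟩
      n G                ≤⟨ n≤ ⟩
      card S + card M    <⟨ +-mono-≤-< (card≤α⁻ S-stable) (≤∧≢⇒< (card≤μ M-matching) M-not-maximum) ⟩
      α⁻ k + μ G         ∎)
      where open ≤-Reasoning

  critical-matching : Matching (isCriticalᵇ G)
  critical-matching with μ-attained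
  ... | V , V-maximum = matching-⊆ (critical⊆maximum V V-maximum) (isMatching⇒Matching V (proj₁ V-maximum))

  η≡card : η G ≡ card (isCriticalᵇ G)
  η≡card = size-tabulate (isCriticalᵇ G)

  η≤μ : η G ≤ μ G
  η≤μ = subst (_≤ μ G) (sym η≡card) (card≤μ critical-matching)

  perfect⇒maximum : ∀ V → IsPerfectMatching G V → IsMaximum V
  perfect⇒maximum V (V-matching , V-perfect) =
    V-matching , ≤-antisym (μ-upper V V-matching) (*-cancelˡ-≤ 2 (≤-trans 2μ≤n (≤-reflexive (sym 2|V|≡n))))
    where
    2|V|≡n : 2 * size V ≡ n G
    2|V|≡n = trans (cong (2 *_) (size≡card V))
                   (perfect⇒2*card≡n (isMatching⇒Matching V V-matching) (covers⇒Covers {V} ∘ V-perfect))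

  module _ (η≡μ : η G ≡ μ G) where

    maximum≡criticalSet : ∀ V → IsMaximum V → V ≡ criticalSet G
    maximum≡criticalSet V V-maximum@(_ , |V|≡μ) = vec-ext λ i →
      trans (⊆-antisym V⊆C (critical⊆maximum V V-maximum) i) (sym (Vec.lookup∘tabulate (isCriticalᵇ G) i))
      where
      V⊆C : vlookup V ⊆ isCriticalᵇ G
      V⊆C = ⊆∧card≡⇒⊇ (critical⊆maximum V V-maximum)
                      (trans (sym η≡card) (trans η≡μ (trans (sym |V|≡μ) (size≡card V))))

    critical-covers-non-isolated : ∀ {v k} → Incident v k → Covers (isCriticalᵇ G) v
    critical-covers-non-isolated = forced-maximum-covers critical-matching maximum forced
      where
      card≡μ : ∀ {X : Fin (m G) → Bool} → card X ≡ card (isCriticalᵇ G) → size (tabulate X) ≡ μ G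
      card≡μ {X} |X|≡|C| = trans (size-tabulate X) (trans |X|≡|C| (trans (sym η≡card) η≡μ))
      maximum : ∀ {X} → Matching X → card X ≤ card (isCriticalᵇ G)
      maximum {X} X-matching = subst (card X ≤_) (trans (sym η≡μ) η≡card) (card≤μ X-matching)
      forced : ∀ {X} → Matching X → card X ≡ card (isCriticalᵇ G) → isCriticalᵇ G ⊆ X
      forced {X} X-matching |X|≡|C| k critical = trans (sym (Vec.lookup∘tabulate X k))
        (critical⊆maximum (tabulate X) (Matching⇒isMatching X-matching , card≡μ |X|≡|C|) k critical)

    η≡μ⇒unique-perfect : Connected G → HasEdge G → HasUniquePerfectMatching G
    η≡μ⇒unique-perfect connected has-edge =
      criticalSet G , (Matching⇒isMatching critical-matching , Covers⇒covers {criticalSet G} ∘ covered) ,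
      λ V V-perfect → maximum≡criticalSet V (perfect⇒maximum V V-perfect)
      where
      covered : ∀ v → Covers (vlookup (criticalSet G)) v
      covered v = covers-⊆ (λ k critical → trans (Vec.lookup∘tabulate (isCriticalᵇ G) k) critical)
                           (critical-covers-non-isolated (proj₂ (incident-edge connected has-edge v)))

  module UniquePerfect (unique-perfect : HasUniquePerfectMatching G) where

    M : EdgeSet G
    M = proj₁ unique-perfect

    M-perfect : IsPerfectMatching G M
    M-perfect = proj₁ (proj₂ unique-perfect)

    M-matching : Matching (vlookup M)
    M-matching = isMatching⇒Matching M (proj₁ M-perfect)

    2|M|≡n : 2 * size M ≡ n G
    2|M|≡n = trans (cong (2 *_) (size≡card M)) (perfect⇒2*card≡n M-matching (covers⇒Covers {M} ∘ proj₂ M-perfect))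

    |M|≡μ : size M ≡ μ G
    |M|≡μ = proj₂ (perfect⇒maximum M M-perfect)

    maximum≡M : ∀ V → IsMaximum V → V ≡ M
    maximum≡M V (V-matching , |V|≡μ) = proj₂ (proj₂ unique-perfect) V (V-matching , Covers⇒covers {V} ∘ V-covered)
      where
      V-covered : ∀ v → Covers (vlookup V) v
      V-covered = 2*card≡n⇒perfect (isMatching⇒Matching V V-matching)
        (trans (cong (2 *_) (trans (sym (size≡card V)) (trans |V|≡μ (sym |M|≡μ)))) 2|M|≡n)

    criticalSet≡M : criticalSet G ≡ M
    criticalSet≡M = vec-ext λ k → trans (Vec.lookup∘tabulate (isCriticalᵇ G) k)
      (⊆-antisym (critical⊆maximum M (perfect⇒maximum M M-perfect)) M⊆C k)
      where
      M⊆C : vlookup M ⊆ isCriticalᵇ G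
      M⊆C k Mk = in-every-maximum⇒critical λ V V-maximum →
        subst (λ W → vlookup W k ≡ true) (sym (maximum≡M V V-maximum)) Mk

    η≡μ : η G ≡ μ G
    η≡μ = trans (cong size criticalSet≡M) |M|≡μ

    2η≡n : 2 * η G ≡ n G
    2η≡n = trans (cong (λ V → 2 * size V) criticalSet≡M) 2|M|≡n

    η≡α : η G ≡ α G
    η≡α = trans η≡μ (+-cancelʳ-≡ (μ G) (μ G) (α G) (trans μ+μ≡n (sym α+μ≡n)))
      where
      μ+μ≡n : μ G + μ G ≡ n G
      μ+μ≡n = trans (cong (μ G +_) (sym (+-identityʳ (μ G)))) (trans (cong (2 *_) (sym |M|≡μ)) 2|M|≡n)

    critical-maximal : IsMaximalMatching G (criticalSet G)
    critical-maximal = subst (IsMaximalMatching G) (sym criticalSet≡M) (proj₁ M-perfect , M-maximal)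
      where
      M-maximal : ∀ V → IsMatching G V → M ⊆ₑ V → V ≡ M
      M-maximal V V-matching M⊆V = vec-ext (⊆-antisym
        (perfect-matching-maximal (isMatching⇒Matching V V-matching) (covers⇒Covers {M} ∘ proj₂ M-perfect) M⊆V) M⊆V)

  maximal⇒η≡μ : IsMaximalMatching G (criticalSet G) → η G ≡ μ G
  maximal⇒η≡μ (_ , maximal) with μ-attained
  ... | V , V-maximum@(_ , |V|≡μ) = trans (cong size (sym V≡C)) |V|≡μ
    where
    V≡C : V ≡ criticalSet G
    V≡C = maximal V (proj₁ V-maximum) λ k Ck →
      critical⊆maximum V V-maximum k (trans (sym (Vec.lookup∘tabulate (isCriticalᵇ G) k)) Ck)

  η≡α⇒η≡μ : η G ≡ α G → η G ≡ μ G
  η≡α⇒η≡μ η≡α = ≤-antisym η≤μ (≤-trans μ≤α (≤-reflexive (sym η≡α)))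

  2η≡n⇒η≡μ : 2 * η G ≡ n G → η G ≡ μ G
  2η≡n⇒η≡μ 2η≡n = ≤-antisym η≤μ (*-cancelˡ-≤ 2 (≤-trans 2μ≤n (≤-reflexive (sym 2η≡n))))

corollary4p3 : (G : Graph) → Connected G → HasEdge G → Bipartite G →
    (HasUniquePerfectMatching G ⇔ IsMaximalMatching G (criticalSet G))
    × (HasUniquePerfectMatching G ⇔ (η G ≡ α G))
    × (HasUniquePerfectMatching G ⇔ (η G ≡ μ G))
    × (HasUniquePerfectMatching G ⇔ (2 * η G ≡ n G))
corollary4p3 G connected has-edge bipartite =
    mk⇔ UniquePerfect.critical-maximal (unique-perfect ∘ maximal⇒η≡μ)
  , mk⇔ UniquePerfect.η≡α (unique-perfect ∘ η≡α⇒η≡μ)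
  , mk⇔ UniquePerfect.η≡μ unique-perfect
  , mk⇔ UniquePerfect.2η≡n (unique-perfect ∘ 2η≡n⇒η≡μ)
  where
  open BipartiteGraph G bipartite
  unique-perfect : η G ≡ μ G → HasUniquePerfectMatching G
  unique-perfect η≡μ = η≡μ⇒unique-perfect η≡μ connected has-edge
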